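{- Let $k\ge 3$ and $0\le n<2k-1$. Then $W^{(k)}_n$ contains no square factor, i.e. no factor $UU$ with $U$ nonempty.
   Context: Words are over $\mathbb{N}$. Define the morphism $\varphi_k$ by $\varphi_k(ki+j)=(ki)(ki+j+1)$ if $0\le j\le k-2$ and $\varphi_k(ki+j)=(ki+j+1)$ if $j=k-1$; let $W^{(k)}_n=\varphi_k^n(0)$. -}

module Defs where

open import Data.Nat using (ℕ; zero; suc; _+_; _*_; _∸_; _<_; NonZero)
open import Data.Nat.Properties using (_<?_)
open import Data.Nat.DivMod using (_/_; _%_)
open import Data.List using (List; []; _∷_; _++_; concatMap)
open import Data.Product using (∃; ∃-syntax; _×_)
open import Relation.Nullary using (¬_; yes; no)
open import Relation.Binary.PropositionalEquality using (_≡_)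

-- The letter image φ_k(m), writing m = k*i + j with 0 ≤ j ≤ k-1:
--   j ≤ k-2  ↦  (k i) (k i + j + 1)
--   j = k-1  ↦  (k i + j + 1)
φ-letter : (k : ℕ) → .{{_ : NonZero k}} → ℕ → List ℕ
φ-letter k m with m % k <? k ∸ 1
... | yes _ = (k * (m / k)) ∷ suc m ∷ []
... | no  _ = suc m ∷ []

φ : (k : ℕ) → .{{_ : NonZero k}} → List ℕ → List ℕ
φ k w = concatMap (φ-letter k) w

W : (k : ℕ) → .{{_ : NonZero k}} → ℕ → List ℕ
W k zero    = 0 ∷ []
W k (suc n) = φ k (W k n)

HasSquare : List ℕ → Set
HasSquare w = ∃[ p ] ∃[ u ] ∃[ s ] (¬ u ≡ []) × (w ≡ p ++ u ++ u ++ s)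

SquareFree : List ℕ → Set
SquareFree w = ¬ HasSquare w

-- On the letters 0 … 2k − 2 the morphism φ_k sends m to the block (0, m+1) for
-- m < k − 1, (k) for m = k − 1 and (k, m+1) for m ≥ k, so every block starts with
-- a "head" letter 0 or k and no other letter is a head.  A square in φ_k(x) can be
-- rotated to start at a head and then be cut along block boundaries.  Comparing
-- the blocks of its two halves, either x contains a square, or the one ambiguity
-- of the blocks, (k) being a prefix of (k, b+1), occurs and x contains the factor
-- v (k−1) v b with b ≥ k.  That factor is impossible in W_n for n ≤ 2k − 3: the
-- letter before k − 1 is always 0 and the letter after 0 is below k, and a factor
-- a b with a < k ≤ b occurs in W_n only if n ≥ k − 1 + a.
module Submission where

open import Data.Empty using (⊥-elim)
open import Data.List using (List; []; _∷_; _++_; _∷ʳ_; concatMap; initLast; _∷ʳ′_)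
open import Data.List.Properties
  using (++-assoc; ++-identityʳ; ++-conicalʳ; ∷-injective; ∷ʳ-injective; concatMap-++)
import Data.List.Relation.Unary.All as All
open All using (All; []; _∷_)
open import Data.List.Relation.Unary.All.Properties using (++⁺; ++⁻ʳ)
open import Data.Nat using (ℕ; zero; suc; _+_; _*_; _∸_; _≤_; _<_; _≟_; z≤n; s≤s; NonZero)
open import Data.Nat.DivMod
  using (_/_; _%_; m<n⇒m%n≡m; m<n⇒m/n≡0; m/n≡1+[m∸n]/n; m≤n⇒[n∸m]%m≡n%m)
open import Data.Nat.Properties
  using ( <-cmp; _<?_; ≤-refl; ≤-trans; ≤-reflexive; <⇒≤; <⇒≱; <-irrefl; <-asym; n<1+n
        ; m≤n⇒m≤1+n; m≤n⇒m<n∨m≡n; 1+n≰n; ≤-pred; +-suc; +-identityʳ; *-zeroʳ; *-identityʳ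
        ; ∸-monoˡ-<; m+n∸n≡m)
open import Data.Product using (_×_; _,_; proj₂; ∃; ∃₂)
open import Data.Sum using (_⊎_; inj₁; inj₂)
open import Relation.Binary using (tri<; tri≈; tri>)
open import Relation.Binary.PropositionalEquality
  using (_≡_; refl; sym; trans; cong; cong₂; subst; module ≡-Reasoning)
open import Relation.Nullary using (¬_; Dec; yes; no; contradiction)
open import Relation.Nullary.Decidable using (_⊎-dec_)

open import Defs

open ≡-Reasoning

Factor : List ℕ → List ℕ → Set
Factor w x = ∃₂ λ p s → x ≡ p ++ w ++ s

Adjacent : ℕ → ℕ → List ℕ → Set
Adjacent a b = Factor (a ∷ b ∷ [])

factor-of-factor : ∀ {w x} u v u′ → w ≡ u ++ v ++ u′ → Factor w x → Factor v x
factor-of-factor u v u′ refl (p , s , refl) = p ++ u , u′ ++ s , (begin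
  p ++ (u ++ v ++ u′) ++ s  ≡⟨ cong (p ++_) (++-assoc u (v ++ u′) s) ⟩
  p ++ u ++ (v ++ u′) ++ s  ≡⟨ cong (λ t → p ++ u ++ t) (++-assoc v u′ s) ⟩
  p ++ u ++ v ++ u′ ++ s    ≡⟨ ++-assoc p u (v ++ u′ ++ s) ⟨
  (p ++ u) ++ v ++ u′ ++ s  ∎)

All-adjacentʳ : ∀ {P : ℕ → Set} {a b x} → All P x → Adjacent a b x → P b
All-adjacentʳ all (p , _ , refl) with ++⁻ʳ p all
... | _ ∷ Pb ∷ _ = Pb

adjacent-singleton : ∀ {a b c} → ¬ Adjacent a b (c ∷ [])
adjacent-singleton ([]        , _ , ())
adjacent-singleton (_ ∷ []    , _ , ())
adjacent-singleton (_ ∷ _ ∷ _ , _ , ())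

singleton-square-free : ∀ a → SquareFree (a ∷ [])
singleton-square-free a (_         , []        , _ , u≢[] , _) = u≢[] refl
singleton-square-free a ([]        , _ ∷ []    , _ , _    , ())
singleton-square-free a ([]        , _ ∷ _ ∷ _ , _ , _    , ())
singleton-square-free a (_ ∷ []    , _ ∷ _     , _ , _    , ())
singleton-square-free a (_ ∷ _ ∷ _ , _ ∷ _     , _ , _    , ())

last-of-pair : ∀ w (h d : ℕ) {p a} → w ++ h ∷ d ∷ [] ≡ p ∷ʳ a → d ≡ a
last-of-pair w h d eq = proj₂ (∷ʳ-injective (w ∷ʳ h) _ (trans (++-assoc w (h ∷ []) (d ∷ [])) eq))

rotate-square : ∀ p (h : ℕ) u s →
  (p ∷ʳ h) ++ (u ∷ʳ h) ++ (u ∷ʳ h) ++ s ≡ p ++ (h ∷ u) ++ (h ∷ u) ++ h ∷ s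
rotate-square p h u s = begin
  (p ∷ʳ h) ++ (u ∷ʳ h) ++ (u ∷ʳ h) ++ s  ≡⟨ ++-assoc p (h ∷ []) _ ⟩
  p ++ h ∷ (u ∷ʳ h) ++ (u ∷ʳ h) ++ s     ≡⟨ cong (λ t → p ++ h ∷ t) (++-assoc u (h ∷ []) _) ⟩
  p ++ h ∷ u ++ h ∷ (u ∷ʳ h) ++ s        ≡⟨ cong (λ t → p ++ h ∷ u ++ h ∷ t)
                                                  (++-assoc u (h ∷ []) s) ⟩
  p ++ h ∷ u ++ h ∷ u ++ h ∷ s           ∎

near-square-assoc : ∀ v (a b : ℕ) y → (v ∷ʳ a) ++ v ++ b ∷ y ≡ (v ++ a ∷ v ++ b ∷ []) ++ y
near-square-assoc v a b y = begin
  (v ∷ʳ a) ++ v ++ b ∷ y           ≡⟨ ++-assoc v (a ∷ []) _ ⟩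
  v ++ a ∷ v ++ b ∷ y              ≡⟨ cong (λ t → v ++ a ∷ t) (++-assoc v (b ∷ []) y) ⟨
  v ++ a ∷ (v ∷ʳ b) ++ y           ≡⟨ ++-assoc v (a ∷ v ∷ʳ b) y ⟨
  (v ++ a ∷ v ++ b ∷ []) ++ y      ∎

module _ (i : ℕ) where

  j k : ℕ
  j = suc i
  k = suc j

  -- ψ is φ_k for k = i + 2 on the letters 0 … 2k − 2 only; on larger letters it is junk.
  ψ : ℕ → List ℕ
  ψ m with <-cmp m j
  ... | tri< _ _ _ = 0 ∷ suc m ∷ []
  ... | tri≈ _ _ _ = k ∷ []
  ... | tri> _ _ _ = k ∷ suc m ∷ []

  data Image (m : ℕ) : List ℕ → Set where
    low  : m < j → Image m (0 ∷ suc m ∷ [])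
    mid  : m ≡ j → Image m (k ∷ [])
    high : j < m → Image m (k ∷ suc m ∷ [])

  image : ∀ m → Image m (ψ m)
  image m with <-cmp m j
  ... | tri< m<j _ _ = low m<j
  ... | tri≈ _ m≡j _ = mid m≡j
  ... | tri> _ _ j<m = high j<m

  Ψ : List ℕ → List ℕ
  Ψ = concatMap ψ

  W′ : ℕ → List ℕ
  W′ zero    = 0 ∷ []
  W′ (suc n) = Ψ (W′ n)

  Ψ-∷ʳ : ∀ w m → Ψ (w ∷ʳ m) ≡ Ψ w ++ ψ m
  Ψ-∷ʳ w m = trans (concatMap-++ ψ w (m ∷ [])) (cong (Ψ w ++_) (++-identityʳ (ψ m)))

  φ-letter-< : ∀ {m} → m % k < j → φ-letter k m ≡ k * (m / k) ∷ suc m ∷ []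
  φ-letter-< {m} lt with m % k <? k ∸ 1
  ... | yes _  = refl
  ... | no ¬lt = contradiction lt ¬lt

  φ-letter-≮ : ∀ {m} → ¬ m % k < j → φ-letter k m ≡ suc m ∷ []
  φ-letter-≮ {m} ¬lt with m % k <? k ∸ 1
  ... | yes lt = contradiction lt ¬lt
  ... | no _   = refl

  φ-letter≡ψ : ∀ {m} → m ≤ j + j → φ-letter k m ≡ ψ m
  φ-letter≡ψ {m} m≤2j with ψ m | image m
  ... | _ | low m<j = begin
    φ-letter k m              ≡⟨ φ-letter-< (subst (_< j) (sym (m<n⇒m%n≡m m<k)) m<j) ⟩
    k * (m / k) ∷ suc m ∷ []  ≡⟨ cong (λ q → k * q ∷ suc m ∷ []) (m<n⇒m/n≡0 m<k) ⟩
    k * 0 ∷ suc m ∷ []        ≡⟨ cong (λ z → z ∷ suc m ∷ []) (*-zeroʳ k) ⟩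
    0 ∷ suc m ∷ []            ∎
    where
    m<k : m < k
    m<k = m≤n⇒m≤1+n m<j
  ... | _ | mid refl = φ-letter-≮ (<-irrefl (m<n⇒m%n≡m (n<1+n j)))
  ... | _ | high k≤m = begin
    φ-letter k m              ≡⟨ φ-letter-< (subst (_< j) (sym m%k≡m∸k) m∸k<j) ⟩
    k * (m / k) ∷ suc m ∷ []  ≡⟨ cong (λ q → k * q ∷ suc m ∷ []) m/k≡1 ⟩
    k * 1 ∷ suc m ∷ []        ≡⟨ cong (λ z → z ∷ suc m ∷ []) (*-identityʳ k) ⟩
    k ∷ suc m ∷ []            ∎
    where
    m∸k<j : m ∸ k < j
    m∸k<j = subst (m ∸ k <_) (m+n∸n≡m j j) (∸-monoˡ-< (s≤s m≤2j) k≤m)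
    m∸k<k : m ∸ k < k
    m∸k<k = m≤n⇒m≤1+n m∸k<j
    m%k≡m∸k : m % k ≡ m ∸ k
    m%k≡m∸k = trans (sym (m≤n⇒[n∸m]%m≡n%m k≤m)) (m<n⇒m%n≡m m∸k<k)
    m/k≡1 : m / k ≡ 1
    m/k≡1 = trans (m/n≡1+[m∸n]/n k≤m) (cong suc (m<n⇒m/n≡0 m∸k<k))

  ψ-bounded : ∀ m → All (_≤ suc m) (ψ m)
  ψ-bounded m with ψ m | image m
  ... | _ | low _    = z≤n ∷ ≤-refl ∷ []
  ... | _ | mid refl = ≤-refl ∷ []
  ... | _ | high k≤m = m≤n⇒m≤1+n k≤m ∷ ≤-refl ∷ []

  Ψ-bounded : ∀ {n x} → All (_≤ n) x → All (_≤ suc n) (Ψ x)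
  Ψ-bounded []         = []
  Ψ-bounded (m≤n ∷ ms) =
    ++⁺ (All.map (λ l≤ → ≤-trans l≤ (s≤s m≤n)) (ψ-bounded _)) (Ψ-bounded ms)

  W′-bounded : ∀ n → All (_≤ n) (W′ n)
  W′-bounded zero    = z≤n ∷ []
  W′-bounded (suc n) = Ψ-bounded (W′-bounded n)

  φ≡Ψ : ∀ {x} → All (_≤ j + j) x → φ k x ≡ Ψ x
  φ≡Ψ []          = refl
  φ≡Ψ (m≤2j ∷ ms) = cong₂ _++_ (φ-letter≡ψ m≤2j) (φ≡Ψ ms)

  W≡W′ : ∀ n → n ≤ j + j → W k n ≡ W′ n
  W≡W′ zero    _    = refl
  W≡W′ (suc n) n<2j = begin
    φ k (W k n)  ≡⟨ cong (φ k) (W≡W′ n (<⇒≤ n<2j)) ⟩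
    φ k (W′ n)   ≡⟨ φ≡Ψ (All.map (λ l≤n → ≤-trans l≤n (<⇒≤ n<2j)) (W′-bounded n)) ⟩
    Ψ (W′ n)     ∎

  IsHead : ℕ → Set
  IsHead c = c ≡ 0 ⊎ c ≡ k

  isHead? : ∀ c → Dec (IsHead c)
  isHead? c = (c ≟ 0) ⊎-dec (c ≟ k)

  j-not-head : ¬ IsHead j
  j-not-head (inj₁ ())
  j-not-head (inj₂ ())

  image-head : ∀ {m c t} → Image m (c ∷ t) → IsHead c
  image-head (low _)  = inj₁ refl
  image-head (mid _)  = inj₂ refl
  image-head (high _) = inj₂ refl

  image-second : ∀ {m h d} → Image m (h ∷ d ∷ []) → ¬ IsHead d
  image-second (low m<j)  (inj₂ refl) = <-irrefl refl m<j
  image-second (high j<m) (inj₂ refl) = <-irrefl refl j<m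

  second-letter-determines-head : ∀ {m m′ h h′ d} →
    Image m (h ∷ d ∷ []) → Image m′ (h′ ∷ d ∷ []) → h ≡ h′
  second-letter-determines-head (low _)    (low _)    = refl
  second-letter-determines-head (low m<j)  (high j<m) = ⊥-elim (<-asym m<j j<m)
  second-letter-determines-head (high j<m) (low m<j)  = ⊥-elim (<-asym m<j j<m)
  second-letter-determines-head (high _)   (high _)   = refl

  ψ-head : ∀ m {t c u} → ψ m ++ t ≡ c ∷ u → IsHead c
  ψ-head m eq with ψ m | image m
  ψ-head m refl | _ | low _  = inj₁ refl
  ψ-head m refl | _ | mid _  = inj₂ refl
  ψ-head m refl | _ | high _ = inj₂ refl

  Ψ-head : ∀ x {c u} → Ψ x ≡ c ∷ u → IsHead c
  Ψ-head (m ∷ x) = ψ-head m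

  ψ-starting-with-k : ∀ m {t u} → ψ m ++ t ≡ k ∷ u → j ≤ m
  ψ-starting-with-k m eq with ψ m | image m
  ψ-starting-with-k m ()   | _ | low _
  ψ-starting-with-k m refl | _ | mid m≡j  = ≤-reflexive (sym m≡j)
  ψ-starting-with-k m refl | _ | high j<m = <⇒≤ j<m

  ψ-ending-below-k : ∀ w m {p a} → w ++ ψ m ≡ p ∷ʳ a → a ≤ j → m < j × a ≡ suc m
  ψ-ending-below-k w m {p} eq a≤j with ψ m | image m
  ... | _ | low m<j  = m<j , sym (last-of-pair w 0 (suc m) eq)
  ... | _ | mid _    with refl ← proj₂ (∷ʳ-injective w p eq) = ⊥-elim (1+n≰n a≤j)
  ... | _ | high j<m with refl ← last-of-pair w k (suc m) eq = ⊥-elim (<-asym j<m a≤j)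

  ψ-after-0 : ∀ m {t b u} → ψ m ++ t ≡ 0 ∷ b ∷ u → b ≤ j
  ψ-after-0 m eq with ψ m | image m
  ψ-after-0 m refl | _ | low m<j = m<j
  ψ-after-0 m ()   | _ | mid _
  ψ-after-0 m ()   | _ | high _

  data Position (x p : List ℕ) (d : ℕ) (r : List ℕ) : Set where
    boundary : ∀ x₁ x₂ → x ≡ x₁ ++ x₂ → Ψ x₁ ≡ p → Ψ x₂ ≡ d ∷ r → Position x p d r
    inner    : ∀ {m h} p₀ → Image m (h ∷ d ∷ []) → p ≡ p₀ ∷ʳ h → Position x p d r

  extend : ∀ {m x p d r} b → ψ m ≡ b → Position x p d r → Position (m ∷ x) (b ++ p) d r
  extend {m} b ψm (boundary x₁ x₂ refl Ψx₁ Ψx₂) =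
    boundary (m ∷ x₁) x₂ refl (cong₂ _++_ ψm Ψx₁) Ψx₂
  extend b ψm (inner p₀ img refl) = inner (b ++ p₀) img (sym (++-assoc b p₀ _))

  mutual
    locate : ∀ x p {d r} → Ψ x ≡ p ++ d ∷ r → Position x p d r
    locate []      []      eq = boundary [] [] refl refl eq
    locate (m ∷ x) p       eq = locate-block x p (image m) refl eq

    locate-block : ∀ {m b} x p {d r} → Image m b → ψ m ≡ b → b ++ Ψ x ≡ p ++ d ∷ r →
                   Position (m ∷ x) p d r
    locate-block x []      _          ψm eq =
      boundary [] (_ ∷ x) refl refl (trans (cong (_++ _) ψm) eq)
    locate-block x (c ∷ p) (mid _)    ψm eq with refl , eq′ ← ∷-injective eq =
      extend (k ∷ []) ψm (locate x p eq′)
    locate-block x (c ∷ p) (low m<j)  ψm eq = locate-pair x p (low m<j) ψm eq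
    locate-block x (c ∷ p) (high j<m) ψm eq = locate-pair x p (high j<m) ψm eq

    locate-pair : ∀ {m h e c} x p {d r} → Image m (h ∷ e ∷ []) → ψ m ≡ h ∷ e ∷ [] →
                  (h ∷ e ∷ []) ++ Ψ x ≡ c ∷ p ++ d ∷ r → Position (m ∷ x) (c ∷ p) d r
    locate-pair x []       img _  refl = inner [] img refl
    locate-pair x (_ ∷ p) _   ψm eq
      with refl , eq′ ← ∷-injective eq
      with refl , eq″ ← ∷-injective eq′ = extend (_ ∷ _ ∷ []) ψm (locate x p eq″)

  cut-at-head : ∀ x {p d r} → IsHead d → Ψ x ≡ p ++ d ∷ r →
                ∃₂ λ x₁ x₂ → x ≡ x₁ ++ x₂ × Ψ x₁ ≡ p × Ψ x₂ ≡ d ∷ r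
  cut-at-head x {p} d-head eq with locate x p eq
  ... | boundary x₁ x₂ x≡ Ψx₁ Ψx₂ = x₁ , x₂ , x≡ , Ψx₁ , Ψx₂
  ... | inner _ img _             = ⊥-elim (image-second img d-head)

  non-head-preceded : ∀ x {p d r} → ¬ IsHead d → Ψ x ≡ p ++ d ∷ r →
                      ∃₂ λ p₀ h → p ≡ p₀ ∷ʳ h × ∃ λ m → Image m (h ∷ d ∷ [])
  non-head-preceded x {p} d-inner eq with locate x p eq
  ... | boundary _ x₂ _ _ Ψx₂ = ⊥-elim (d-inner (Ψ-head x₂ Ψx₂))
  ... | inner p₀ img p≡        = p₀ , _ , p≡ , _ , img

  non-head-pair : ∀ x {p a d r} → ¬ IsHead d → Ψ x ≡ p ++ a ∷ d ∷ r →
                  ∃ λ m → Image m (a ∷ d ∷ [])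
  non-head-pair x {p} {a} d-inner eq
    with p₀ , _ , p≡ , m , img ←
           non-head-preceded x d-inner (trans eq (sym (++-assoc p (a ∷ []) _)))
    with refl ← proj₂ (∷ʳ-injective p p₀ p≡) = m , img

  HeadSquare : List ℕ → Set
  HeadSquare w = ∃₂ λ p c → ∃₂ λ u s → IsHead c × w ≡ p ++ (c ∷ u) ++ (c ∷ u) ++ s

  -- A square starting at a non-head letter d is shifted one letter to the left:
  -- both occurrences of d are preceded by the same head.
  head-square : ∀ x → HasSquare (Ψ x) → HeadSquare (Ψ x)
  head-square x (_ , []    , _ , u≢[] , _)  = ⊥-elim (u≢[] refl)
  head-square x (p , d ∷ u , s , _    , eq) with isHead? d
  ... | yes d-head = p , d , u , s , d-head , eq
  ... | no  d-inner
    with p₀ , h , refl , _ , img ← non-head-preceded x d-inner eq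
    with p₁ , h′ , u≡ , _ , img′ ← non-head-preceded x {p₀ ∷ʳ h ++ d ∷ u} d-inner
                                     (trans eq (sym (++-assoc (p₀ ∷ʳ h) (d ∷ u) _)))
    with refl ← second-letter-determines-head img img′
    with initLast u
  ... | [] with refl ← proj₂ (∷ʳ-injective (p₀ ∷ʳ h) p₁ u≡) = ⊥-elim (d-inner (image-head img))
  ... | u₀ ∷ʳ′ h″
    with refl ← proj₂ (∷ʳ-injective (p₀ ∷ʳ h ++ d ∷ u₀) p₁
                                    (trans (++-assoc (p₀ ∷ʳ h) (d ∷ u₀) _) u≡)) =
    p₀ , h , d ∷ u₀ , h ∷ s , image-head img , trans eq (rotate-square p₀ h (d ∷ u₀) s)

  compare-images : ∀ a b {R} y → ψ a ++ R ≡ ψ b ++ Ψ y →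
                   a ≡ b × R ≡ Ψ y ⊎ a ≡ j × j < b × R ≡ suc b ∷ Ψ y
  compare-images a b y eq with ψ a | image a | ψ b | image b
  compare-images _ _ _ refl | _ | low _      | _ | low _      = inj₁ (refl , refl)
  compare-images _ _ _ ()   | _ | low _      | _ | mid _
  compare-images _ _ _ ()   | _ | low _      | _ | high _
  compare-images _ _ _ ()   | _ | mid _      | _ | low _
  compare-images _ _ _ refl | _ | mid a≡j    | _ | mid b≡j    =
    inj₁ (trans a≡j (sym b≡j) , refl)
  compare-images _ _ _ refl | _ | mid a≡j    | _ | high j<b   = inj₂ (a≡j , j<b , refl)
  compare-images _ _ _ ()   | _ | high _     | _ | low _
  compare-images _ _ y eq   | _ | high j<a   | _ | mid _      =
    ⊥-elim (image-second (high j<a) (Ψ-head y (sym (proj₂ (∷-injective eq)))))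
  compare-images _ _ _ refl | _ | high _     | _ | high _     = inj₁ (refl , refl)

  Ψ-prefix : ∀ v y {s} → Ψ v ++ s ≡ Ψ y →
             (∃ λ y′ → y ≡ v ++ y′) ⊎
             (∃₂ λ v₀ b → ∃ λ y′ → v ≡ v₀ ∷ʳ j × y ≡ v₀ ++ b ∷ y′ × j < b)
  Ψ-prefix []      y       eq = inj₁ (y , refl)
  Ψ-prefix (a ∷ v) []      eq with ψ a | image a
  Ψ-prefix (a ∷ v) []      () | _ | low _
  Ψ-prefix (a ∷ v) []      () | _ | mid _
  Ψ-prefix (a ∷ v) []      () | _ | high _
  Ψ-prefix (a ∷ v) (b ∷ y) {s} eq
    with compare-images a b y (trans (sym (++-assoc (ψ a) (Ψ v) s)) eq)
  ... | inj₁ (refl , eq′) with Ψ-prefix v y eq′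
  ...   | inj₁ (y′ , refl)                         = inj₁ (y′ , refl)
  ...   | inj₂ (v₀ , b′ , y′ , refl , refl , j<b′) = inj₂ (a ∷ v₀ , b′ , y′ , refl , refl , j<b′)
  Ψ-prefix (a ∷ v) (b ∷ y) {s} eq | inj₂ (refl , j<b , eq′) with v
  ... | []     = inj₂ ([] , b , y , refl , refl , j<b)
  ... | m ∷ v′ =
    ⊥-elim (image-second (high j<b) (ψ-head m (trans (sym (++-assoc (ψ m) (Ψ v′) s)) eq′)))

  nonempty-preimage : ∀ v {c u} → Ψ v ≡ c ∷ u → ¬ v ≡ []
  nonempty-preimage (_ ∷ _) _ ()

  desubstitute : ∀ x → HasSquare (Ψ x) →
                 HasSquare x ⊎ ∃₂ λ v b → j < b × Factor (v ++ j ∷ v ++ b ∷ []) x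
  desubstitute x sq
    with p , c , u , s , c-head , eq ← head-square x sq
    with x₁ , x₂ , refl , refl , Ψx₂ ← cut-at-head x c-head eq
    with v , x₃ , refl , Ψv , Ψx₃ ← cut-at-head x₂ {c ∷ u} c-head Ψx₂
    with Ψ-prefix v x₃ (trans (cong (_++ s) Ψv) (sym Ψx₃))
  ... | inj₁ (y , refl) = inj₁ (x₁ , v , y , nonempty-preimage v Ψv , refl)
  ... | inj₂ (v₀ , b , y , refl , refl , j<b) =
    inj₂ (v₀ , b , j<b , x₁ , y , cong (x₁ ++_) (near-square-assoc v₀ j b y))

  letter-before-j≡0 : ∀ n {e} → Adjacent e j (W′ n) → e ≡ 0
  letter-before-j≡0 zero    adj          = ⊥-elim (adjacent-singleton adj)
  letter-before-j≡0 (suc n) (p , s , eq) with non-head-pair (W′ n) j-not-head eq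
  ... | _ , low _    = refl
  ... | _ , high j<m = ⊥-elim (<-asym (n<1+n i) j<m)

  letter-after-0≤j : ∀ n {b} → Adjacent 0 b (W′ n) → b ≤ j
  letter-after-0≤j zero    adj          = ⊥-elim (adjacent-singleton adj)
  letter-after-0≤j (suc n) (p , s , eq) with cut-at-head (W′ n) (inj₁ refl) eq
  ... | _ , []    , _ , _ , ()
  ... | _ , m ∷ _ , _ , _ , Ψx₂ = ψ-after-0 m Ψx₂

  crossing-preimage : ∀ x {a y} → Adjacent a y (Ψ x) → a ≤ j → j < y →
                      ∃₂ λ m m′ → a ≡ suc m × m < j × j ≤ m′ × Adjacent m m′ x
  crossing-preimage x (p , s , eq) a≤j j<y with isHead? _
  ... | no y-inner with non-head-pair x y-inner eq
  ...   | _ , low m<j = ⊥-elim (<⇒≱ j<y m<j)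
  ...   | _ , high _  = ⊥-elim (1+n≰n a≤j)
  crossing-preimage x (p , s , eq) a≤j () | yes (inj₁ refl)
  crossing-preimage x {a} (p , s , eq) a≤j j<y | yes (inj₂ refl)
    with x₁ , x₂ , refl , Ψx₁ , Ψx₂ ←
           cut-at-head x (inj₂ refl) (trans eq (sym (++-assoc p (a ∷ []) _)))
    with initLast x₁ | x₂
  ... | []       | _        with () ← ++-conicalʳ p (a ∷ []) (sym Ψx₁)
  ... | _ ∷ʳ′ _  | []       with () ← Ψx₂
  ... | x₀ ∷ʳ′ m | m′ ∷ x₂′
    with m<j , refl ← ψ-ending-below-k (Ψ x₀) m (trans (sym (Ψ-∷ʳ x₀ m)) Ψx₁) a≤j =
    m , m′ , refl , m<j , ψ-starting-with-k m′ Ψx₂ , x₀ , x₂′ , ++-assoc x₀ (m ∷ []) (m′ ∷ x₂′)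

  crossing-bound : ∀ n {a y} → Adjacent a y (W′ n) → a ≤ j → j < y → j + a ≤ n
  crossing-bound zero    adj _ _ = ⊥-elim (adjacent-singleton adj)
  crossing-bound (suc n) adj a≤j j<y
    with m , m′ , refl , m<j , j≤m′ , adj′ ← crossing-preimage (W′ n) adj a≤j j<y
    rewrite +-suc j m
    with m≤n⇒m<n∨m≡n j≤m′
  ... | inj₁ j<m′ = s≤s (crossing-bound n adj′ (<⇒≤ m<j) j<m′)
  ... | inj₂ refl with refl ← letter-before-j≡0 n adj′ =
    s≤s (subst (_≤ n) (sym (+-identityʳ j)) (All-adjacentʳ (W′-bounded n) adj′))

  near-square-free : ∀ n {v b} → suc n ≤ j + j → j < b →
                     ¬ Factor (v ++ j ∷ v ++ b ∷ []) (W′ n)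
  near-square-free n {v} {b} n<2j j<b fac with initLast v
  ... | []       = <⇒≱ n<2j (crossing-bound n fac ≤-refl j<b)
  ... | v₀ ∷ʳ′ e =
    <⇒≱ j<b (letter-after-0≤j n (subst (λ c → Adjacent c b (W′ n)) (letter-before-j≡0 n e-j) e-b))
    where
    e-j : Adjacent e j (W′ n)
    e-j = factor-of-factor v₀ (e ∷ j ∷ []) (v₀ ∷ʳ e ++ b ∷ []) (++-assoc v₀ (e ∷ []) _) fac
    e-b : Adjacent e b (W′ n)
    e-b = factor-of-factor (v₀ ∷ʳ e ++ j ∷ v₀) (e ∷ b ∷ []) []
            (trans (cong (λ t → v₀ ∷ʳ e ++ j ∷ t) (++-assoc v₀ (e ∷ []) (b ∷ [])))
                   (sym (++-assoc (v₀ ∷ʳ e) (j ∷ v₀) (e ∷ b ∷ []))))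
            fac

  square-free : ∀ n → n ≤ j + j → SquareFree (W′ n)
  square-free zero    _    = singleton-square-free 0
  square-free (suc n) n<2j sq with desubstitute (W′ n) sq
  ... | inj₁ sq′                 = square-free n (<⇒≤ n<2j) sq′
  ... | inj₂ (_ , _ , j<b , fac) = near-square-free n n<2j j<b fac

  2k∸1≡1+2j : 2 * k ∸ 1 ≡ suc (j + j)
  2k∸1≡1+2j = trans (+-suc j (j + 0)) (cong (λ t → suc (j + t)) (+-identityʳ j))

-- The argument only needs k ≥ 2.
lemma17 : (k n : ℕ) → .{{_ : NonZero k}} → 3 ≤ k → n < 2 * k ∸ 1 → SquareFree (W k n)
lemma17 zero          _ ()
lemma17 (suc zero)    _ (s≤s ())
lemma17 (suc (suc i)) n _ n<2k∸1 =
  subst SquareFree (sym (W≡W′ i n n≤2j)) (square-free i n n≤2j)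
  where
  n≤2j : n ≤ suc i + suc i
  n≤2j = ≤-pred (subst (n <_) (2k∸1≡1+2j i) n<2k∸1)
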